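{- If $G$ is an equimatchable claw-free graph with an odd number of vertices and $\alpha(G)\ge3$, then $\kappa(G)\le 3$.
   Context: $\alpha(G)$ is the independence number and $\kappa(G)$ the vertex connectivity (size of a smallest vertex set whose removal disconnects $G$). A graph is equimatchable if all its maximal matchings have the same cardinality; claw-free if it has no induced $K_{1,3}$. -}

module Defs where

open import Data.Nat using (ℕ; _≤_)
open import Data.Fin using (Fin)
open import Data.Fin.Subset using (Subset; _∈_; _∉_; ∣_∣)
open import Data.List using (List; length)
open import Data.List.Relation.Unary.All using (All)
open import Data.List.Relation.Unary.Any using (Any)
open import Data.List.Relation.Unary.AllPairs using (AllPairs)
open import Data.Product using (Σ; _×_; _,_; proj₁; proj₂; ∃)
open import Data.Sum using (_⊎_)
open import Relation.Binary.PropositionalEquality using (_≡_; _≢_)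
open import Relation.Nullary using (¬_; Dec)

record Graph (n : ℕ) : Set₁ where
  field
    Adj   : Fin n → Fin n → Set
    adj?  : ∀ u v → Dec (Adj u v)
    sym   : ∀ {u v} → Adj u v → Adj v u
    irrefl : ∀ {u} → ¬ Adj u u
open Graph public

module _ {n : ℕ} (G : Graph n) where

  Edge : Fin n × Fin n → Set
  Edge e = Adj G (proj₁ e) (proj₂ e)

  Incident : Fin n → Fin n × Fin n → Set
  Incident v e = (v ≡ proj₁ e) ⊎ (v ≡ proj₂ e)

  Disjoint : Fin n × Fin n → Fin n × Fin n → Set
  Disjoint e f = ¬ (Incident (proj₁ e) f ⊎ Incident (proj₂ e) f)

  -- a matching: a list of edges of G, pairwise vertex-disjoint
  -- (so in particular the listed edges are distinct); its size is its length
  IsMatching : List (Fin n × Fin n) → Set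
  IsMatching M = All Edge M × AllPairs Disjoint M

  Covered : List (Fin n × Fin n) → Fin n → Set
  Covered M v = Any (Incident v) M

  IsMaximalMatching : List (Fin n × Fin n) → Set
  IsMaximalMatching M =
    IsMatching M × (∀ u v → Adj G u v → Covered M u ⊎ Covered M v)

  Equimatchable : Set
  Equimatchable = ∀ M M' → IsMaximalMatching M → IsMaximalMatching M' →
                  length M ≡ length M'

  ClawFree : Set
  ClawFree = ∀ c a b d → Adj G c a → Adj G c b → Adj G c d →
             a ≢ b → a ≢ d → b ≢ d →
             ¬ (¬ Adj G a b × ¬ Adj G a d × ¬ Adj G b d)

  IndependentSet : Subset n → Set
  IndependentSet S = ∀ u v → u ∈ S → v ∈ S → ¬ Adj G u v

  IndependenceNumber≥ : ℕ → Set
  IndependenceNumber≥ k = Σ (Subset n) λ S → IndependentSet S × k ≤ ∣ S ∣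

  data Reach (S : Subset n) : Fin n → Fin n → Set where
    here : ∀ {u} → u ∉ S → Reach S u u
    step : ∀ {u v w} → u ∉ S → Adj G u v → Reach S v w → Reach S u w

  Separates : Subset n → Set
  Separates S = Σ (Fin n) λ u → Σ (Fin n) λ v → u ∉ S × v ∉ S × ¬ Reach S u v

  Connectivity≤ : ℕ → Set
  Connectivity≤ k = Σ (Subset n) λ S → Separates S × ∣ S ∣ ≤ k

-- A claw-free graph has a matching missing at most one vertex of each component
-- (Sumner, Las Vergnas), constructively: if two exposed vertices x, y are joined by
-- a path x x₁ x₂ … y, then either x₁ is exposed, or x can be rematched along the
-- edge x₁Y of the matching so that a strictly shorter path between exposed
-- vertices appears; claw-freeness at x₁ is what guarantees that Y sees x₂.
-- Applying this to G − S for S = ∅ and for an independent 3-set T shows that,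
-- unless one of them separates G, G has a maximal matching missing at most one
-- vertex, while the near-perfect matching of G − T extends by at most one edge
-- (from the unique exposed vertex into T) to a maximal matching missing at least
-- two vertices of T. Equimatchability makes the two sizes equal: contradiction.

module Submission where

open import Defs
open import Level using (Level)
open import Data.Nat using (ℕ; zero; suc; _+_; _*_; _≤_; _<_; z≤n; s≤s)
open import Data.Nat.Properties
  using (≤-refl; ≤-trans; ≤-reflexive; ≤-antisym; <⇒≱; 1+n≰n; n<1+n; n≤1+n; m<n⇒m<1+n; m≤n⇒m≤1+n;
         m≤n+m; m≤n*m; +-suc; +-identityʳ; +-comm; +-monoˡ-≤; +-monoʳ-≤; *-suc; *-monoʳ-≤; module ≤-Reasoning)
open import Data.Nat.Induction using (<-wellFounded)
open import Induction.WellFounded using (Acc; acc)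
open import Data.Fin using (Fin; zero; suc; _≟_)
open import Data.Fin.Properties using (any?)
open import Data.Fin.Subset using (Subset; _∈_; _∉_; ∣_∣; ⊥; ⊤; ⁅_⁆; _∪_; _⊂_; inside; outside)
  renaming (_⊆_ to _⊆ˢ_)
open import Data.Fin.Subset.Properties
  using (_∈?_; drop-there; ∉⊥; ∈⊤; ∣⊥∣≡0; ∣⊤∣≡n; ∣⁅x⁆∣≡1; ∣p∣≤n; x∈⁅x⁆; x∈⁅y⁆⇒x≡y; p⊆p∪q; x∈p∪q⁺; x∈p∪q⁻;
         p⊂q⇒∣p∣<∣q∣; ⊆-min; s⊆s)
open import Data.Vec using ([]; _∷_; here; there)
open import Data.List using (List; []; _∷_; length)
open import Data.List.Relation.Unary.All using (All; []; _∷_)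
import Data.List.Relation.Unary.All as All
open import Data.List.Relation.Unary.Any using (here; there; toSum; fromSum)
import Data.List.Relation.Unary.Any as Any
open import Data.List.Relation.Unary.AllPairs using ([]; _∷_)
open import Data.Empty using (⊥-elim)
open import Data.Product using (Σ; Σ-syntax; ∃; _×_; _,_; proj₁; proj₂)
open import Data.Sum using (_⊎_; inj₁; inj₂)
import Data.Sum as Sum
open import Function using (id; _∘_)
open import Relation.Binary.PropositionalEquality
  using (_≡_; _≢_; refl; ≢-sym; cong; subst; module ≡-Reasoning)
import Relation.Binary.PropositionalEquality as ≡
open import Relation.Nullary using (¬_; Dec; yes; no)
open import Relation.Nullary.Decidable using (_×-dec_; _⊎-dec_; ¬?; decidable-stable)
open import Relation.Unary using (Pred; Decidable; _⊆_; _≐_; _∩_; Empty; Universal)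
open import Relation.Unary.Properties using (_∪?_)

-- Counting vertices

private
  variable
    n : ℕ
    ℓ ℓ₁ ℓ₂ : Level

count : {P : Pred (Fin n) ℓ} → Decidable P → ℕ
count {n = zero}  P? = 0
count {n = suc n} P? with P? zero
... | yes _ = suc (count (P? ∘ suc))
... | no  _ = count (P? ∘ suc)

count-mono : ∀ {n} {P : Pred (Fin n) ℓ₁} {Q : Pred (Fin n) ℓ₂} (P? : Decidable P) (Q? : Decidable Q) →
             P ⊆ Q → count P? ≤ count Q?
count-mono {n = zero}  P? Q? P⊆Q = z≤n
count-mono {n = suc n} P? Q? P⊆Q with P? zero | Q? zero
... | yes _ | yes _ = s≤s (count-mono (P? ∘ suc) (Q? ∘ suc) P⊆Q)
... | yes p | no ¬q = ⊥-elim (¬q (P⊆Q p))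
... | no _  | yes _ = m≤n⇒m≤1+n (count-mono (P? ∘ suc) (Q? ∘ suc) P⊆Q)
... | no _  | no _  = count-mono (P? ∘ suc) (Q? ∘ suc) P⊆Q

count-≐ : {P : Pred (Fin n) ℓ₁} {Q : Pred (Fin n) ℓ₂} (P? : Decidable P) (Q? : Decidable Q) →
          P ≐ Q → count P? ≡ count Q?
count-≐ P? Q? (P⊆Q , Q⊆P) = ≤-antisym (count-mono P? Q? P⊆Q) (count-mono Q? P? Q⊆P)

count-∪ : ∀ {n} {P : Pred (Fin n) ℓ₁} {Q : Pred (Fin n) ℓ₂} (P? : Decidable P) (Q? : Decidable Q) →
          Empty (P ∩ Q) → count (P? ∪? Q?) ≡ count P? + count Q?
count-∪ {n = zero}  P? Q? disjoint = refl
count-∪ {n = suc n} P? Q? disjoint with P? zero | Q? zero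
... | yes p | yes q = ⊥-elim (disjoint zero (p , q))
... | yes _ | no _  = cong suc (count-∪ (P? ∘ suc) (Q? ∘ suc) (disjoint ∘ suc))
... | no _  | yes _ = ≡.trans (cong suc (count-∪ (P? ∘ suc) (Q? ∘ suc) (disjoint ∘ suc)))
                            (≡.sym (+-suc _ _))
... | no _  | no _  = count-∪ (P? ∘ suc) (Q? ∘ suc) (disjoint ∘ suc)

count-∈ : (p : Subset n) → count (_∈? p) ≡ ∣ p ∣
count-∈ []            = refl
count-∈ (inside ∷ p)  = cong suc (≡.trans (count-≐ _ (_∈? p) (drop-there , there)) (count-∈ p))
count-∈ (outside ∷ p) = ≡.trans (count-≐ _ (_∈? p) (drop-there , there)) (count-∈ p)

module _ {P : Pred (Fin n) ℓ} (P? : Decidable P) where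

  count≤n : count P? ≤ n
  count≤n = ≤-trans (count-mono P? (_∈? ⊤ {n}) (λ _ → ∈⊤))
                    (≤-reflexive (≡.trans (count-∈ (⊤ {n})) (∣⊤∣≡n n)))

  count-universal : Universal P → count P? ≡ n
  count-universal all =
    ≡.trans (count-≐ P? (_∈? ⊤ {n}) ((λ _ → ∈⊤) , λ {x} _ → all x)) (≡.trans (count-∈ (⊤ {n})) (∣⊤∣≡n n))

  count-empty : Empty P → count P? ≡ 0
  count-empty none =
    ≡.trans (count-≐ P? (_∈? ⊥ {n}) ((λ {x} p → ⊥-elim (none x p)) , λ x∈⊥ → ⊥-elim (∉⊥ x∈⊥)))
            (≡.trans (count-∈ (⊥ {n})) (∣⊥∣≡0 n))

count-singleton : (u : Fin n) → count (_≟ u) ≡ 1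
count-singleton u =
  ≡.trans (count-≐ (_≟ u) (_∈? ⁅ u ⁆) ((λ { refl → x∈⁅x⁆ u }) , x∈⁅y⁆⇒x≡y u))
          (≡.trans (count-∈ ⁅ u ⁆) (∣⁅x⁆∣≡1 u))

⊆-of-size : ∀ {n k} (p : Subset n) → k ≤ ∣ p ∣ → ∃ λ q → q ⊆ˢ p × ∣ q ∣ ≡ k
⊆-of-size {n} {zero} p             _           = ⊥ , ⊆-min p , ∣⊥∣≡0 n
⊆-of-size {k = suc k} (inside ∷ p)  (s≤s k≤∣p∣) with ⊆-of-size p k≤∣p∣
... | q , q⊆p , ∣q∣≡k = inside ∷ q , s⊆s q⊆p , cong suc ∣q∣≡k
⊆-of-size {k = suc k} (outside ∷ p) k<∣p∣       with ⊆-of-size p k<∣p∣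
... | q , q⊆p , ∣q∣≡k = outside ∷ q , s⊆s q⊆p , ∣q∣≡k

-- Paths in G − S

module _ {n : ℕ} (G : Graph n) where

  pathLength : ∀ {S u v} → Reach G S u v → ℕ
  pathLength (here _)     = 0
  pathLength (step _ _ r) = suc (pathLength r)

  Reach-source∉ : ∀ {S u v} → Reach G S u v → u ∉ S
  Reach-source∉ (here u∉S)     = u∉S
  Reach-source∉ (step u∉S _ _) = u∉S

  Reach-antimono : ∀ {S S′ u v} → S ⊆ˢ S′ → Reach G S′ u v → Reach G S u v
  Reach-antimono S⊆S′ (here u∉S′)     = here (λ u∈S → u∉S′ (S⊆S′ u∈S))
  Reach-antimono S⊆S′ (step u∉S′ a r) =
    step (λ u∈S → u∉S′ (S⊆S′ u∈S)) a (Reach-antimono S⊆S′ r)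

  ∉-∪-⁅⁆ : ∀ {S : Subset n} {w u} → w ∉ S → w ≢ u → w ∉ S ∪ ⁅ u ⁆
  ∉-∪-⁅⁆ {S} {u = u} w∉S w≢u w∈ with x∈p∪q⁻ S ⁅ u ⁆ w∈
  ... | inj₁ w∈S  = w∉S w∈S
  ... | inj₂ w∈⁅u⁆ = w≢u (x∈⁅y⁆⇒x≡y u w∈⁅u⁆)

  last-visit : ∀ {S x v} u → v ≢ u → Reach G S x v →
               Reach G (S ∪ ⁅ u ⁆) x v ⊎ ∃ λ w → Adj G u w × Reach G (S ∪ ⁅ u ⁆) w v
  last-visit u v≢u (here v∉S) = inj₁ (here (∉-∪-⁅⁆ v∉S v≢u))
  last-visit {x = x} u v≢u (step {v = y} x∉S x~y r) with last-visit u v≢u r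
  ... | inj₂ exit = inj₂ exit
  ... | inj₁ r′ with x ≟ u
  ...   | yes refl = inj₂ (y , x~y , r′)
  ...   | no x≢u   = inj₁ (step (∉-∪-⁅⁆ x∉S x≢u) x~y r′)

  leave : ∀ {S u v} → u ≢ v → Reach G S u v → ∃ λ w → Adj G u w × Reach G (S ∪ ⁅ u ⁆) w v
  leave {S} {u} u≢v r with last-visit u (λ v≡u → u≢v (≡.sym v≡u)) r
  ... | inj₁ r′   = ⊥-elim (Reach-source∉ r′ (x∈p∪q⁺ (inj₂ (x∈⁅x⁆ u))))
  ... | inj₂ exit = exit

  reach-within? : ∀ k S → n < ∣ S ∣ + k → ∀ u v → Dec (Reach G S u v)
  reach-within? zero S bound u v =
    ⊥-elim (<⇒≱ (≤-trans bound (≤-reflexive (+-identityʳ _))) (∣p∣≤n S))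
  reach-within? (suc k) S bound u v with u ∈? S
  ... | yes u∈S = no (λ r → Reach-source∉ r u∈S)
  ... | no u∉S with u ≟ v
  ...   | yes refl = yes (here u∉S)
  ...   | no u≢v
          with any? (λ w → adj? G u w ×-dec reach-within? k (S ∪ ⁅ u ⁆) bound′ w v)
          where
            S⊂S∪u : S ⊂ S ∪ ⁅ u ⁆
            S⊂S∪u = p⊆p∪q ⁅ u ⁆ , u , x∈p∪q⁺ (inj₂ (x∈⁅x⁆ u)) , u∉S
            bound′ : n < ∣ S ∪ ⁅ u ⁆ ∣ + k
            bound′ = ≤-trans bound (≤-trans (≤-reflexive (+-suc _ k))
                                            (+-monoˡ-≤ k (p⊂q⇒∣p∣<∣q∣ S⊂S∪u)))
  ...     | yes (w , u~w , r) = yes (step u∉S u~w (Reach-antimono (p⊆p∪q ⁅ u ⁆) r))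
  ...     | no ¬exit          = no (λ r → ¬exit (leave u≢v r))

  reach? : ∀ S u v → Dec (Reach G S u v)
  reach? S = reach-within? (suc n) S (m≤n+m (suc n) ∣ S ∣)

-- Matchings

module _ {n : ℕ} (G : Graph n) where

  private
    Edges : Set
    Edges = List (Fin n × Fin n)

  Exposed : Edges → Fin n → Set
  Exposed M w = ¬ Covered G M w

  covered? : ∀ M → Decidable (Covered G M)
  covered? M w = Any.any? (λ e → (w ≟ proj₁ e) ⊎-dec (w ≟ proj₂ e)) M

  covered≢exposed : ∀ {M u w} → Covered G M u → Exposed M w → u ≢ w
  covered≢exposed u-cov w-exp refl = w-exp u-cov

  adjacent⇒≢ : ∀ {u v} → Adj G u v → u ≢ v
  adjacent⇒≢ u~v refl = irrefl G u~v

  exposed-∷ : ∀ {M u v w} → w ≢ u → w ≢ v → Exposed M w → Exposed ((u , v) ∷ M) w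
  exposed-∷ w≢u w≢v w-exp (here (inj₁ w≡u)) = w≢u w≡u
  exposed-∷ w≢u w≢v w-exp (here (inj₂ w≡v)) = w≢v w≡v
  exposed-∷ w≢u w≢v w-exp (there w-cov)     = w-exp w-cov

  disjoint⇒exposed : ∀ {M u v} → All (Disjoint G (u , v)) M → Exposed M u × Exposed M v
  disjoint⇒exposed []       = (λ ()) , (λ ())
  disjoint⇒exposed (d ∷ ds) =
    Sum.[ (λ i → d (inj₁ i)) , proj₁ (disjoint⇒exposed ds) ] ∘ toSum ,
    Sum.[ (λ i → d (inj₂ i)) , proj₂ (disjoint⇒exposed ds) ] ∘ toSum

  exposed⇒disjoint : ∀ {M u v} → Exposed M u → Exposed M v → All (Disjoint G (u , v)) M
  exposed⇒disjoint {[]}    u-exp v-exp = []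
  exposed⇒disjoint {_ ∷ M} u-exp v-exp =
    Sum.[ u-exp ∘ here , v-exp ∘ here ] ∷ exposed⇒disjoint (u-exp ∘ there) (v-exp ∘ there)

  matching-∷ : ∀ {M u v} → Adj G u v → Exposed M u → Exposed M v → IsMatching G M →
               IsMatching G ((u , v) ∷ M)
  matching-∷ u~v u-exp v-exp (edges , disjoint) =
    u~v ∷ edges , exposed⇒disjoint u-exp v-exp ∷ disjoint

  matching-head-exposed : ∀ {M u v} → IsMatching G ((u , v) ∷ M) → Exposed M u × Exposed M v
  matching-head-exposed (_ , ds ∷ _) = disjoint⇒exposed ds

  matching-tail : ∀ {M e} → IsMatching G (e ∷ M) → IsMatching G M
  matching-tail (_ ∷ edges , _ ∷ disjoint) = edges , disjoint

  disjoint-sym : ∀ {e f} → Disjoint G e f → Disjoint G f e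
  disjoint-sym d (inj₁ (inj₁ eq)) = d (inj₁ (inj₁ (≡.sym eq)))
  disjoint-sym d (inj₁ (inj₂ eq)) = d (inj₂ (inj₁ (≡.sym eq)))
  disjoint-sym d (inj₂ (inj₁ eq)) = d (inj₁ (inj₂ (≡.sym eq)))
  disjoint-sym d (inj₂ (inj₂ eq)) = d (inj₂ (inj₂ (≡.sym eq)))

  matching-swap : ∀ {M e f} → IsMatching G (e ∷ f ∷ M) → IsMatching G (f ∷ e ∷ M)
  matching-swap (a ∷ b ∷ edges , (d ∷ ds) ∷ ds′ ∷ disjoint) =
    b ∷ a ∷ edges , (disjoint-sym d ∷ ds′) ∷ ds ∷ disjoint

  matching-flip : ∀ {M u v} → IsMatching G ((u , v) ∷ M) → IsMatching G ((v , u) ∷ M)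
  matching-flip (u~v ∷ edges , ds ∷ disjoint) =
    sym G u~v ∷ edges , All.map (_∘ Sum.swap) ds ∷ disjoint

  covered-flip⊆ : ∀ {M u v} → Covered G ((u , v) ∷ M) ⊆ Covered G ((v , u) ∷ M)
  covered-flip⊆ (here i)  = here (Sum.swap i)
  covered-flip⊆ (there c) = there c

  -- M is, up to the order of its edges and their orientation, (v , partner) ∷ others.
  record EdgeAt (M : Edges) (v : Fin n) : Set where
    field
      partner    : Fin n
      others     : Edges
      matching   : IsMatching G ((v , partner) ∷ others)
      length-≡   : length M ≡ suc (length others)
      covered-≐  : Covered G M ≐ Covered G ((v , partner) ∷ others)

    partner-adjacent : Adj G v partner
    partner-adjacent = All.head (proj₁ matching)

    vertex-covered : Covered G M v
    vertex-covered = proj₂ covered-≐ (here (inj₁ refl))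

    partner-covered : Covered G M partner
    partner-covered = proj₂ covered-≐ (here (inj₂ refl))

    others⊆ : Covered G others ⊆ Covered G M
    others⊆ = proj₂ covered-≐ ∘ there

  edgeAt : ∀ {M v} → IsMatching G M → Covered G M v → EdgeAt M v
  edgeAt {(p , q) ∷ R} m (here (inj₁ refl)) = record
    { partner = q ; others = R ; matching = m ; length-≡ = refl ; covered-≐ = id , id }
  edgeAt {(p , q) ∷ R} m (here (inj₂ refl)) = record
    { partner = p ; others = R ; matching = matching-flip m ; length-≡ = refl
    ; covered-≐ = covered-flip⊆ , covered-flip⊆ }
  edgeAt {(p , q) ∷ R} {v} m (there v-cov) = record
    { partner    = partner
    ; others     = (p , q) ∷ others
    ; matching   = matching-swap (matching-∷ (All.head (proj₁ m))
                     (proj₁ pq-exposed ∘ proj₂ covered-≐) (proj₂ pq-exposed ∘ proj₂ covered-≐)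
                     matching)
    ; length-≡   = cong suc length-≡
    ; covered-≐  = into , out-of }
    where
      open EdgeAt (edgeAt (matching-tail m) v-cov)
      pq-exposed = matching-head-exposed m
      into : Covered G ((p , q) ∷ R) ⊆ Covered G ((v , partner) ∷ (p , q) ∷ others)
      into (here i)  = there (here i)
      into (there c) = Sum.[ here , (λ c′ → there (there c′)) ] (toSum (proj₁ covered-≐ c))
      out-of : Covered G ((v , partner) ∷ (p , q) ∷ others) ⊆ Covered G ((p , q) ∷ R)
      out-of (here i)          = there (proj₂ covered-≐ (here i))
      out-of (there (here i))  = here i
      out-of (there (there c)) = there (proj₂ covered-≐ (there c))

  partnerEdge : ∀ {M v} (e : EdgeAt M v) → EdgeAt M (EdgeAt.partner e)
  partnerEdge {v = v} e = record
    { partner    = v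
    ; others     = others
    ; matching   = matching-flip matching
    ; length-≡   = length-≡
    ; covered-≐  = covered-flip⊆ ∘ proj₁ covered-≐ , proj₂ covered-≐ ∘ covered-flip⊆ }
    where open EdgeAt e

  covered-count : ∀ {M} → IsMatching G M → count (covered? M) ≡ 2 * length M
  covered-count {[]}          _ = count-empty (covered? []) (λ _ ())
  covered-count {(u , v) ∷ M} m = begin
    count (covered? ((u , v) ∷ M))
      ≡⟨ count-≐ (covered? _) (endpoint? ∪? covered? M) (toSum , fromSum) ⟩
    count (endpoint? ∪? covered? M)
      ≡⟨ count-∪ endpoint? (covered? M) endpoints-exposed ⟩
    count endpoint? + count (covered? M)
      ≡⟨ ≡.cong₂ _+_ endpoints-count (covered-count (matching-tail m)) ⟩
    2 + 2 * length M
      ≡⟨ ≡.sym (*-suc 2 (length M)) ⟩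
    2 * suc (length M) ∎
    where
      open ≡-Reasoning
      endpoint? = (_≟ u) ∪? (_≟ v)
      endpoints-count : count endpoint? ≡ 2
      endpoints-count =
        ≡.trans (count-∪ (_≟ u) (_≟ v) (λ { _ (refl , refl) → irrefl G (All.head (proj₁ m)) }))
                (≡.cong₂ _+_ (count-singleton u) (count-singleton v))
      endpoints-exposed : Empty ((λ w → Incident G w (u , v)) ∩ Covered G M)
      endpoints-exposed _ (inj₁ refl , u-cov) = proj₁ (matching-head-exposed m) u-cov
      endpoints-exposed _ (inj₂ refl , v-cov) = proj₂ (matching-head-exposed m) v-cov

  length≤n : ∀ {M} → IsMatching G M → length M ≤ n
  length≤n {M} m = ≤-trans (m≤n*m (length M) 2)
                           (≤-trans (≤-reflexive (≡.sym (covered-count m))) (count≤n (covered? M)))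

  exposed-independent⇒maximal : ∀ {M} → IsMatching G M →
    (∀ {u v} → Exposed M u → Exposed M v → ¬ Adj G u v) → IsMaximalMatching G M
  exposed-independent⇒maximal {M} m independent = m , maximal
    where
      maximal : ∀ u v → Adj G u v → Covered G M u ⊎ Covered G M v
      maximal u v u~v with covered? M u | covered? M v
      ... | yes u-cov | _         = inj₁ u-cov
      ... | no _      | yes v-cov = inj₂ v-cov
      ... | no u-exp  | no v-exp  = ⊥-elim (independent u-exp v-exp u~v)

  claw-free-neighbours : ClawFree G → ∀ {c a b d} → Adj G c a → Adj G c b → Adj G c d →
    a ≢ b → a ≢ d → b ≢ d → ¬ Adj G a b → ¬ Adj G a d → Adj G b d
  claw-free-neighbours claw-free {c} {a} {b} {d} c~a c~b c~d a≢b a≢d b≢d a≁b a≁d =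
    decidable-stable (adj? G b d)
      (λ b≁d → claw-free c a b d c~a c~b c~d a≢b a≢d b≢d (a≁b , a≁d , b≁d))

-- Augmenting matchings of G − S

module _ {n : ℕ} (G : Graph n) (S : Subset n) where

  record MatchingOutside : Set where
    field
      edges      : List (Fin n × Fin n)
      isMatching : IsMatching G edges
      avoids     : ∀ {w} → Covered G edges w → w ∉ S

  open MatchingOutside

  size : MatchingOutside → ℕ
  size M = length (edges M)

  MatchingOfSize : ℕ → Set
  MatchingOfSize k = Σ[ M ∈ MatchingOutside ] size M ≡ k

  record ExposedPath (M : MatchingOutside) : Set where
    constructor exposedPath
    field
      source target  : Fin n
      source≢target  : source ≢ target
      source-exposed : Exposed G (edges M) source
      target-exposed : Exposed G (edges M) target
      path           : Reach G S source target

  open ExposedPath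

  Shortening : MatchingOutside → ℕ → Set
  Shortening M ℓ = Σ[ M′ ∈ MatchingOutside ] size M′ ≡ size M ×
                   Σ[ p ∈ ExposedPath M′ ] pathLength G (path p) < ℓ

  extend : (M : MatchingOutside) → ∀ {u v} → Adj G u v →
           Exposed G (edges M) u → Exposed G (edges M) v → u ∉ S → v ∉ S →
           MatchingOfSize (suc (size M))
  extend M {u} {v} u~v u-exp v-exp u∉S v∉S = record
    { edges      = (u , v) ∷ edges M
    ; isMatching = matching-∷ G u~v u-exp v-exp (isMatching M)
    ; avoids     = avoids′ }
    , refl
    where
      avoids′ : ∀ {w} → Covered G ((u , v) ∷ edges M) w → w ∉ S
      avoids′ (here (inj₁ refl)) = u∉S
      avoids′ (here (inj₂ refl)) = v∉S
      avoids′ (there w-cov)      = avoids M w-cov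

  -- The source takes over v; the former partner of v becomes exposed and starts the new path.
  rematch : (M : MatchingOutside) (p : ExposedPath M) → ∀ {v ℓ} → Adj G (source p) v →
            (e : EdgeAt G (edges M) v) → (r : Reach G S (EdgeAt.partner e) (target p)) →
            pathLength G r < ℓ → Shortening M ℓ
  rematch M (exposedPath x y x≢y x-exp y-exp x↝y) {v} x~v e r r<ℓ =
    M′ , ≡.trans size≡ (≡.sym length-≡) , exposedPath partner y partner≢y partner-exp y-exp′ r , r<ℓ
    where
      open EdgeAt e
      rest : MatchingOutside
      rest = record
        { edges = others ; isMatching = matching-tail G matching ; avoids = avoids M ∘ others⊆ }
      head-exposed = matching-head-exposed G matching
      extended = extend rest x~v (x-exp ∘ others⊆) (proj₁ head-exposed)
                        (Reach-source∉ G x↝y) (avoids M vertex-covered)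
      M′ = proj₁ extended
      size≡ = proj₂ extended
      partner≢y : partner ≢ y
      partner≢y = covered≢exposed G partner-covered y-exp
      partner-exp : Exposed G ((x , v) ∷ others) partner
      partner-exp = exposed-∷ G (covered≢exposed G partner-covered x-exp)
                      (≢-sym (adjacent⇒≢ G partner-adjacent)) (proj₂ head-exposed)
      y-exp′ : Exposed G ((x , v) ∷ others) y
      y-exp′ = exposed-∷ G (≢-sym x≢y) (≢-sym (covered≢exposed G vertex-covered y-exp))
                 (y-exp ∘ others⊆)

  unchanged : (M : MatchingOutside) → ∀ {x y ℓ} → x ≢ y →
              Exposed G (edges M) x → Exposed G (edges M) y →
              (r : Reach G S x y) → pathLength G r < ℓ → Shortening M ℓ
  unchanged M x≢y x-exp y-exp r r<ℓ = M , refl , exposedPath _ _ x≢y x-exp y-exp r , r<ℓ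

  -- Let x → x₁ → x₂ be the start of the path, with x₁ matched to Y.  Either x
  -- can skip x₁, or x can take Y from x₁, or x takes x₁ and then, by claw-freeness
  -- at x₁, the exposed Y reaches x₂ in one step.
  augment-step : ClawFree G → (M : MatchingOutside) (p : ExposedPath M) →
                 MatchingOfSize (suc (size M)) ⊎ Shortening M (pathLength G (path p))
  augment-step claw-free M (exposedPath x y x≢y x-exp y-exp (here _)) = ⊥-elim (x≢y refl)
  augment-step claw-free M p@(exposedPath x y x≢y x-exp y-exp (step {v = x₁} x∉S x~x₁ x₁↝y))
    with covered? G (edges M) x₁
  ... | no x₁-exp  = inj₁ (extend M x~x₁ x-exp x₁-exp x∉S (Reach-source∉ G x₁↝y))
  ... | yes x₁-cov = inj₂ (detour x₁↝y)
    where
      e = edgeAt G (isMatching M) x₁-cov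
      open EdgeAt e using (partner-adjacent; partner-covered) renaming (partner to Y)

      Y≢x : Y ≢ x
      Y≢x = covered≢exposed G partner-covered x-exp

      detour : (r₁ : Reach G S x₁ y) → Shortening M (suc (pathLength G r₁))
      detour (here _) = ⊥-elim (y-exp x₁-cov)
      detour (step {v = x₂} x₁∉S x₁~x₂ x₂↝y) with x₂ ≟ x | adj? G x x₂ | adj? G x Y
      ... | yes refl | _        | _       =
        unchanged M x≢y x-exp y-exp x₂↝y (m<n⇒m<1+n (n<1+n _))
      ... | no _     | yes x~x₂ | _       =
        unchanged M x≢y x-exp y-exp (step x∉S x~x₂ x₂↝y) (n<1+n _)
      ... | no _     | no _     | yes x~Y =
        rematch M p x~Y (partnerEdge G e) (step x₁∉S x₁~x₂ x₂↝y) (n<1+n _)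
      ... | no x₂≢x  | no x≁x₂  | no x≁Y  =
        rematch M p x~x₁ e (proj₁ Y↝y) (proj₂ Y↝y)
        where
          Y↝y : Σ[ r ∈ Reach G S Y y ] pathLength G r < suc (suc (pathLength G x₂↝y))
          Y↝y with x₂ ≟ Y
          ... | yes refl = x₂↝y , m<n⇒m<1+n (n<1+n _)
          ... | no x₂≢Y  = step (avoids M partner-covered) (sym G x₂~Y) x₂↝y , n<1+n _
            where
              x₂~Y : Adj G x₂ Y
              x₂~Y = claw-free-neighbours G claw-free (sym G x~x₁) x₁~x₂ partner-adjacent
                       (≢-sym x₂≢x) (≢-sym Y≢x) x₂≢Y x≁x₂ x≁Y

  augment : ClawFree G → (M : MatchingOutside) → ExposedPath M → MatchingOfSize (suc (size M))
  augment claw-free M p = go M p (<-wellFounded _)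
    where
      go : (M : MatchingOutside) (p : ExposedPath M) → Acc _<_ (pathLength G (path p)) →
           MatchingOfSize (suc (size M))
      go M p (acc shorter) with augment-step claw-free M p
      ... | inj₁ larger = larger
      ... | inj₂ (M′ , size≡ , p′ , p′<p) =
        subst (MatchingOfSize ∘ suc) size≡ (go M′ p′ (shorter p′<p))

  NearPerfect : MatchingOutside → Set
  NearPerfect M = ∀ {x y} → x ∉ S → y ∉ S → Exposed G (edges M) x → Exposed G (edges M) y → x ≡ y

  separating-or-near-perfect : ClawFree G → Separates G S ⊎ Σ MatchingOutside NearPerfect
  separating-or-near-perfect claw-free = grow (suc n) empty (n<1+n n)
    where
      empty : MatchingOutside
      empty = record { edges = [] ; isMatching = [] , [] ; avoids = λ () }

      grow : ∀ fuel (M : MatchingOutside) → n < size M + fuel →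
             Separates G S ⊎ Σ MatchingOutside NearPerfect
      grow zero M bound =
        ⊥-elim (<⇒≱ (≤-trans bound (≤-reflexive (+-identityʳ _))) (length≤n G (isMatching M)))
      grow (suc fuel) M bound
        with any? (λ x → any? (λ y → ¬? (x ∈? S) ×-dec ¬? (y ∈? S) ×-dec
               ¬? (covered? G (edges M) x) ×-dec ¬? (covered? G (edges M) y) ×-dec ¬? (x ≟ y)))
      ... | no none = inj₂ (M , near-perfect)
        where
          near-perfect : NearPerfect M
          near-perfect {x} {y} x∉S y∉S x-exp y-exp =
            decidable-stable (x ≟ y) (λ x≢y → none (x , y , x∉S , y∉S , x-exp , y-exp , x≢y))
      ... | yes (x , y , x∉S , y∉S , x-exp , y-exp , x≢y) with reach? G S x y
      ...   | no x↝̸y = inj₁ (x , y , x∉S , y∉S , x↝̸y)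
      ...   | yes x↝y with augment claw-free M (exposedPath x y x≢y x-exp y-exp x↝y)
      ...     | M′ , size≡ = grow fuel M′ (subst (λ k → n < k + fuel) (≡.sym size≡)
                                             (≤-trans bound (≤-reflexive (+-suc (size M) fuel))))

  -- Completing near-perfect matchings

  ExposedOutside : MatchingOutside → Set
  ExposedOutside M = ∃ λ z → z ∉ S × Exposed G (edges M) z

  exposed-outside? : (M : MatchingOutside) → Dec (ExposedOutside M)
  exposed-outside? M = any? (λ z → ¬? (z ∈? S) ×-dec ¬? (covered? G (edges M) z))

  exposed⇒∈ : ∀ M {u} → ¬ ExposedOutside M → Exposed G (edges M) u → u ∈ S
  exposed⇒∈ M {u} none u-exp = decidable-stable (u ∈? S) (λ u∉S → none (u , u∉S , u-exp))

  exposed⇒∈⊎≡ : ∀ M {u z} → NearPerfect M → z ∉ S → Exposed G (edges M) z →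
                Exposed G (edges M) u → u ∈ S ⊎ u ≡ z
  exposed⇒∈⊎≡ M {u} near z∉S z-exp u-exp with u ∈? S
  ... | yes u∈S = inj₁ u∈S
  ... | no u∉S  = inj₂ (near u∉S z∉S u-exp z-exp)

  covered-or-in? : (M : MatchingOutside) → Decidable (λ w → Covered G (edges M) w ⊎ w ∈ S)
  covered-or-in? M = covered? G (edges M) ∪? (_∈? S)

  count-covered-or-in : (M : MatchingOutside) → count (covered-or-in? M) ≡ 2 * size M + ∣ S ∣
  count-covered-or-in M =
    ≡.trans (count-∪ (covered? G (edges M)) (_∈? S) (λ _ (w-cov , w∈S) → avoids M w-cov w∈S))
            (≡.cong₂ _+_ (covered-count G (isMatching M)) (count-∈ S))

  count-covered-or-in-or-≡ : (M : MatchingOutside) → ∀ {z} → z ∉ S → Exposed G (edges M) z →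
    count (covered-or-in? M ∪? (_≟ z)) ≡ suc (2 * size M + ∣ S ∣)
  count-covered-or-in-or-≡ M {z} z∉S z-exp =
    ≡.trans (count-∪ (covered-or-in? M) (_≟ z) z-apart)
            (≡.trans (≡.cong₂ _+_ (count-covered-or-in M) (count-singleton z)) (+-comm _ 1))
    where
      z-apart : Empty (λ w → (Covered G (edges M) w ⊎ w ∈ S) × w ≡ z)
      z-apart _ (inj₁ z-cov , refl) = z-exp z-cov
      z-apart _ (inj₂ z∈S   , refl) = z∉S z∈S

  size-bound : (M : MatchingOutside) → 2 * size M + ∣ S ∣ ≤ n
  size-bound M =
    ≤-trans (≤-reflexive (≡.sym (count-covered-or-in M))) (count≤n (covered-or-in? M))

  near-perfect-lower-bound : (M : MatchingOutside) → NearPerfect M → n ≤ suc (2 * size M + ∣ S ∣)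
  near-perfect-lower-bound M near with exposed-outside? M
  ... | no none = ≤-trans (≤-reflexive (≡.trans (≡.sym (count-universal (covered-or-in? M) classify))
                                                  (count-covered-or-in M)))
                          (n≤1+n _)
    where
      classify : ∀ w → Covered G (edges M) w ⊎ w ∈ S
      classify w with covered? G (edges M) w
      ... | yes w-cov = inj₁ w-cov
      ... | no w-exp  = inj₂ (exposed⇒∈ M none w-exp)
  ... | yes (z , z∉S , z-exp) =
    ≤-reflexive (≡.trans (≡.sym (count-universal (covered-or-in? M ∪? (_≟ z)) classify))
                         (count-covered-or-in-or-≡ M z∉S z-exp))
    where
      classify : ∀ w → (Covered G (edges M) w ⊎ w ∈ S) ⊎ w ≡ z
      classify w with covered? G (edges M) w
      ... | yes w-cov = inj₁ (inj₁ w-cov)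
      ... | no w-exp  = Sum.map₁ inj₂ (exposed⇒∈⊎≡ M near z∉S z-exp w-exp)

  -- At most one vertex z outside the independent set S is exposed, so at most one
  -- edge (from z into S) is missing for maximality.
  maximal-completion : IndependentSet G S → (M : MatchingOutside) → NearPerfect M →
    Σ[ M′ ∈ List (Fin n × Fin n) ]
      IsMaximalMatching G M′ × size M ≤ length M′ × 2 * length M′ + ∣ S ∣ ≤ suc n
  maximal-completion independent M near with exposed-outside? M
  ... | no none =
    edges M ,
    exposed-independent⇒maximal G (isMatching M)
      (λ u-exp v-exp → independent _ _ (exposed⇒∈ M none u-exp) (exposed⇒∈ M none v-exp)) ,
    ≤-refl , ≤-trans (size-bound M) (n≤1+n n)
  ... | yes (z , z∉S , z-exp) with any? (λ s → s ∈? S ×-dec adj? G z s)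
  ...   | yes (s , s∈S , z~s) =
    (z , s) ∷ edges M ,
    exposed-independent⇒maximal G matching′
      (λ u-exp v-exp → independent _ _ (in-S u-exp) (in-S v-exp)) ,
    n≤1+n _ ,
    ≤-trans (≤-reflexive (cong (_+ ∣ S ∣) (*-suc 2 (size M))))
            (s≤s (≤-trans (≤-reflexive (≡.sym (count-covered-or-in-or-≡ M z∉S z-exp)))
                          (count≤n _)))
    where
      matching′ : IsMatching G ((z , s) ∷ edges M)
      matching′ = matching-∷ G z~s z-exp (λ s-cov → avoids M s-cov s∈S) (isMatching M)
      in-S : ∀ {u} → Exposed G ((z , s) ∷ edges M) u → u ∈ S
      in-S u-exp with exposed⇒∈⊎≡ M near z∉S z-exp (u-exp ∘ there)
      ... | inj₁ u∈S = u∈S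
      ... | inj₂ refl = ⊥-elim (u-exp (here (inj₁ refl)))
  ...   | no z-isolated =
    edges M , exposed-independent⇒maximal G (isMatching M) independent′ ,
    ≤-refl , ≤-trans (size-bound M) (n≤1+n n)
    where
      independent′ : ∀ {u v} → Exposed G (edges M) u → Exposed G (edges M) v → ¬ Adj G u v
      independent′ u-exp v-exp u~v
        with exposed⇒∈⊎≡ M near z∉S z-exp u-exp | exposed⇒∈⊎≡ M near z∉S z-exp v-exp
      ... | inj₁ u∈S  | inj₁ v∈S  = independent _ _ u∈S v∈S u~v
      ... | inj₁ u∈S  | inj₂ refl = z-isolated (_ , u∈S , sym G u~v)
      ... | inj₂ refl | inj₁ v∈S  = z-isolated (_ , v∈S , u~v)
      ... | inj₂ refl | inj₂ refl = irrefl G u~v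

-- Equimatchable claw-free graphs

∅-independent : ∀ {n} (G : Graph n) → IndependentSet G ⊥
∅-independent G _ _ u∈⊥ _ = ⊥-elim (∉⊥ u∈⊥)

-- Completed to maximal matchings, A′ leaves at least two vertices exposed and B′ at most one.
no-near-perfect-matching : ∀ {n} {G : Graph n} {T : Subset n} →
  Equimatchable G → IndependentSet G T → 3 ≤ ∣ T ∣ →
  Σ (MatchingOutside G T) (NearPerfect G T) → ¬ Σ (MatchingOutside G ⊥) (NearPerfect G ⊥)
no-near-perfect-matching {n} {G} {T} equimatchable T-independent 3≤∣T∣ (A , A-near) (B , B-near)
  with maximal-completion G T T-independent A A-near
     | maximal-completion G ⊥ (∅-independent G) B B-near
... | A′ , A′-maximal , _ , A′-bound | B′ , B′-maximal , B≤B′ , _ = 1+n≰n (begin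
      suc (suc (suc (2 * a′)))   ≡⟨ +-comm 3 _ ⟩
      2 * a′ + 3                 ≤⟨ +-monoʳ-≤ (2 * a′) 3≤∣T∣ ⟩
      2 * a′ + ∣ T ∣             ≤⟨ A′-bound ⟩
      suc n                      ≤⟨ s≤s (near-perfect-lower-bound G ⊥ B B-near) ⟩
      suc (suc (2 * b + ∣ ⊥ {n} ∣)) ≡⟨ cong (λ k → suc (suc (2 * b + k))) (∣⊥∣≡0 n) ⟩
      suc (suc (2 * b + 0))      ≡⟨ cong (λ k → suc (suc k)) (+-identityʳ _) ⟩
      suc (suc (2 * b))          ≤⟨ s≤s (s≤s (*-monoʳ-≤ 2 (≤-trans B≤B′ (≤-reflexive b′≡a′)))) ⟩
      suc (suc (2 * a′))         ∎)
  where
    open ≤-Reasoning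
    a′ = length A′
    b = size G ⊥ B
    b′≡a′ : length B′ ≡ a′
    b′≡a′ = equimatchable B′ A′ B′-maximal A′-maximal

corollary2 : (n : ℕ) → (G : Graph n) → Σ ℕ (λ k → n ≡ 1 + 2 * k) →
    Equimatchable G → ClawFree G → IndependenceNumber≥ G 3 →
    Connectivity≤ G 3
corollary2 n G _ equimatchable claw-free (I , I-independent , 3≤∣I∣) with ⊆-of-size I 3≤∣I∣
... | T , T⊆I , ∣T∣≡3
  with separating-or-near-perfect G T claw-free | separating-or-near-perfect G ⊥ claw-free
... | inj₁ T-separates | _              = T , T-separates , ≤-reflexive ∣T∣≡3
... | inj₂ _           | inj₁ ∅-separates = ⊥ , ∅-separates , ≤-trans (≤-reflexive (∣⊥∣≡0 n)) z≤n
... | inj₂ A           | inj₂ B         =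
  ⊥-elim (no-near-perfect-matching equimatchable T-independent (≤-reflexive (≡.sym ∣T∣≡3)) A B)
  where
    T-independent : IndependentSet G T
    T-independent u v u∈T v∈T = I-independent u v (T⊆I u∈T) (T⊆I v∈T)
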